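{- Let $r,m,s$ be positive integers with $s\le r-m$, and let $G$ be any $(2,s)$-e.c. graph. Then $\sigma(G,r,m)\ge s+1$. In particular, if $G$ is $(2,r-m)$-e.c., then $\sigma(G,r,m)=r-m+1$.
   Context: For positive integers $l,k$, a graph $G$ is $(l,k)$-existentially closed ($(l,k)$-e.c.) if for any two disjoint sets $A,B\subseteq V(G)$ with $|A|=l$, $|B|=k$, there is a vertex $z\in V(G)\setminus(A\cup B)$ adjacent to every vertex of $A$ and to no vertex of $B$. Game of Revolutionaries and Spies on $G$: $r$ revolutionaries and $s$ spies. First the revolutionaries occupy vertices (several may share a vertex), then the spies. In each subsequent round each revolutionary may move to an adjacent vertex or stay, then each spy likewise; perfect information and optimal play. A meeting is at least $m$ revolutionaries on one vertex; unguarded if no spy is there. Revolutionaries win if at the end of some round there is an unguarded meeting; spies win if they prevent this forever. $\sigma(G,r,m)$ is the minimum number of spies needed for the spies to win. -}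

module Defs where

open import Data.Nat using (ℕ; zero; suc; _+_; _∸_; _≤_)
open import Data.Fin using (Fin; toℕ)
open import Data.Vec using (Vec; tabulate)
open import Data.Product using (Σ; _×_; ∃; ∃-syntax)
open import Data.Sum using (_⊎_)
open import Relation.Nullary using (¬_; Dec)
open import Relation.Binary.PropositionalEquality using (_≡_; _≢_)
open import Function.Definitions using (Injective)

record Graph (n : ℕ) : Set₁ where
  field
    Adj    : Fin n → Fin n → Set
    sym    : ∀ {u v} → Adj u v → Adj v u
    irrefl : ∀ {u} → ¬ Adj u u
    dec    : ∀ u v → Dec (Adj u v)
open Graph public

IsEC : ∀ {n} → Graph n → ℕ → ℕ → Set
IsEC {n} G l k =
  (A : Fin l → Fin n) (B : Fin k → Fin n) →
  Injective _≡_ _≡_ A → Injective _≡_ _≡_ B →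
  (∀ i j → A i ≢ B j) →
  ∃[ z ] ((∀ i → z ≢ A i) × (∀ j → z ≢ B j) ×
          (∀ i → Adj G z (A i)) × (∀ j → ¬ Adj G z (B j)))

-- Positions of k players (several may share a vertex).
Conf : ℕ → ℕ → Set
Conf n k = Fin k → Fin n

Step : ∀ {n k} → Graph n → Conf n k → Conf n k → Set
Step G P Q = ∀ i → P i ≡ Q i ⊎ Adj G (P i) (Q i)

UnguardedMeeting : ∀ {n r s} → ℕ → Conf n r → Conf n s → Set
UnguardedMeeting {n} {r} m R S =
  ∃[ v ] ((Σ (Fin m → Fin r) λ f → Injective _≡_ _≡_ f × (∀ j → R (f j) ≡ v))
          × (∀ k → S k ≢ v))

-- A play of the revolutionaries: configuration after their move in each round
-- (round 0 = initial placement).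
LegalRevPlay : ∀ {n r} → Graph n → (ℕ → Conf n r) → Set
LegalRevPlay G ρ = ∀ t → Step G (ρ t) (ρ (suc t))

history : ∀ {n r} → (ℕ → Conf n r) → (t : ℕ) → Vec (Conf n r) (suc t)
history ρ t = tabulate (λ i → ρ (toℕ i))

-- A spy strategy (perfect information): in round t the spies' configuration is
-- a function of the revolutionaries' configurations in rounds 0..t (the spies'
-- own earlier positions are determined by these).
SpyStrategy : ℕ → ℕ → ℕ → Set
SpyStrategy n r s = (t : ℕ) → Vec (Conf n r) (suc t) → Conf n s

spyPlay : ∀ {n r s} → SpyStrategy n r s → (ℕ → Conf n r) → ℕ → Conf n s
spyPlay σ ρ t = σ t (history ρ t)

SpiesWin : ∀ {n} → Graph n → (r m s : ℕ) → Set
SpiesWin {n} G r m s =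
  Σ (SpyStrategy n r s) λ σ →
    (ρ : ℕ → Conf n r) → LegalRevPlay G ρ →
      (∀ t → Step G (spyPlay σ ρ t) (spyPlay σ ρ (suc t))) ×
      (∀ t → ¬ UnguardedMeeting m (ρ t) (spyPlay σ ρ t))

σ≥ : ∀ {n} → Graph n → (r m b : ℕ) → Set
σ≥ G r m b = ∀ k → suc k ≤ b → ¬ SpiesWin G r m k

σ≡ : ∀ {n} → Graph n → (r m b : ℕ) → Set
σ≡ G r m b = SpiesWin G r m b × σ≥ G r m b

-- Start with all revolutionaries on one vertex; if a spy guards it, the
-- revolutionaries follow a plan (x, x′, y): x ≠ x′ are spy-free and hold the "gathered"
-- revolutionaries, and y holds spies.  Each round the gathered ones move to a common neighbour w
-- of x and x′ that is neither occupied by nor adjacent to a spy, so w is still spy-free after the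
-- spies move; if at least m were gathered, this is an unguarded meeting.  Otherwise one
-- revolutionary on y steps to y₀ and the rest to y₁, where y₀, y₁ are neighbours of y (and of each
-- other) apart from every spy not on y, so only spies from y can reach them.  If y₁ is left
-- unguarded, w and y₁ together hold at least m; if only y₀ is, w and y₀ hold one more gathered
-- revolutionary; if both are guarded, fewer spies remain on y₁ than were on y.  The invariant
-- m + #spies(y) ≤ #gathered + #revolutionaries(y) survives each round, and the pair
-- (#spies(y), r ∸ #gathered) decreases lexicographically, so a meeting is eventually forced.
-- The common neighbours exist by (2,s)-existential closure; s + 2 ≤ n lets the set of spy
-- positions, of size at most s, be padded to size exactly s.
--
-- Upper bound.  r ∸ m + 1 spies shadow fixed revolutionaries, leaving only m − 1 others free to
-- form an unguarded meeting.

module Submission where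

open import Defs renaming (sym to Adj-sym)
open import Data.Nat using (ℕ; zero; suc; _+_; _*_; _∸_; _≤_; _<_; z≤n; s≤s; _≤?_; _<?_)
open import Data.Nat.Properties hiding (_≟_; suc-injective)
open import Algebra.Properties.CommutativeMonoid.Sum +-0-commutativeMonoid using (sum; ∑-distrib-+)
open import Data.Empty using (⊥; ⊥-elim)
open import Data.Fin using (Fin; zero; suc; toℕ; fromℕ; fromℕ<; inject₁; inject≤; _≟_; _↑ˡ_; _↑ʳ_)
open import Data.Fin.Properties
  using (any?; ¬∀⟶∃¬; injective⇒≤; suc-injective; toℕ-fromℕ; toℕ-fromℕ<; toℕ-inject₁; toℕ-inject≤;
         toℕ-injective; toℕ<n)
open import Data.Maybe using (Maybe; just; nothing)
open import Data.Product using (Σ; ∃; _×_; _,_; proj₁; proj₂)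
open import Data.Sum using (_⊎_; inj₁; inj₂; [_,_]′)
open import Data.Unit using (tt)
open import Data.Vec as Vec using (Vec; [_]; _∷ʳ_; last; lookup; tabulate)
open import Data.Vec.Properties using (last-∷ʳ; lookup∘tabulate; tabulate-cong)
open import Data.Vec.Functional using (Vector; _∷_; []; _++_)
open import Data.Vec.Functional.Properties using (lookup-++ˡ; lookup-++ʳ)
open import Function using (_∘_)
open import Function.Definitions using (Injective)
open import Level using (_⊔_)
open import Relation.Binary.Definitions using (DecidableEquality)
open import Relation.Binary.PropositionalEquality
  using (_≡_; _≢_; refl; sym; trans; cong; cong₂; subst; subst₂; module ≡-Reasoning)
open import Relation.Nullary using (¬_; Dec; yes; no; ¬?)
open import Relation.Nullary.Decidable using (_×-dec_)
open import Relation.Unary using (Pred; Decidable; _⊆_; _∪_)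

ind : ∀ {a} {A : Set a} → Dec A → ℕ
ind (yes _) = 1
ind (no _)  = 0

ind-mono : ∀ {a b} {A : Set a} {B : Set b} → (A → B) → (d : Dec A) (e : Dec B) → ind d ≤ ind e
ind-mono A⇒B (yes α) (yes _) = ≤-refl
ind-mono A⇒B (yes α) (no ¬β) = ⊥-elim (¬β (A⇒B α))
ind-mono A⇒B (no _)  _       = z≤n

module _ {a b c} {A : Set a} {B : Set b} {C : Set c} where

  ind-disjoint : (A → B → ⊥) → (A → C) → (B → C) →
                 (d : Dec A) (e : Dec B) (f : Dec C) → ind d + ind e ≤ ind f
  ind-disjoint A∩B A⇒C B⇒C (yes α) (yes β) f = ⊥-elim (A∩B α β)
  ind-disjoint A∩B A⇒C B⇒C (yes α) (no _)  f = ind-mono A⇒C (yes α) f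
  ind-disjoint A∩B A⇒C B⇒C (no _)  e       f = ind-mono B⇒C e f

  ind-cover : (C → A ⊎ B) → (d : Dec A) (e : Dec B) (f : Dec C) → ind f ≤ ind d + ind e
  ind-cover C⇒A∪B d e (no _)  = z≤n
  ind-cover C⇒A∪B d e (yes γ) with C⇒A∪B γ
  ... | inj₁ α = ≤-trans (ind-mono (λ _ → α) (yes γ) d) (m≤m+n _ _)
  ... | inj₂ β = ≤-trans (ind-mono (λ _ → β) (yes γ) e) (m≤n+m _ _)

count : ∀ {a p} {P : Pred (Fin a) p} → Decidable P → ℕ
count P? = sum (λ i → ind (P? i))

sum-mono : ∀ {a} {f g : Vector ℕ a} → (∀ i → f i ≤ g i) → sum f ≤ sum g
sum-mono {zero}  f≤g = z≤n
sum-mono {suc a} f≤g = +-mono-≤ (f≤g zero) (sum-mono (f≤g ∘ suc))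

module _ {a p q u} {P : Pred (Fin a) p} {Q : Pred (Fin a) q} {R : Pred (Fin a) u}
         (P? : Decidable P) (Q? : Decidable Q) (R? : Decidable R) where

  count-disjoint : (∀ {i} → P i → Q i → ⊥) → P ⊆ R → Q ⊆ R →
                   count P? + count Q? ≤ count R?
  count-disjoint P∩Q P⊆R Q⊆R = begin
    count P? + count Q?                 ≡⟨ ∑-distrib-+ (ind ∘ P?) (ind ∘ Q?) ⟨
    sum (λ i → ind (P? i) + ind (Q? i)) ≤⟨ sum-mono (λ i → ind-disjoint P∩Q P⊆R Q⊆R (P? i) (Q? i) (R? i)) ⟩
    count R?                            ∎
    where open ≤-Reasoning

  count-cover : R ⊆ P ∪ Q → count R? ≤ count P? + count Q?
  count-cover R⊆P∪Q = begin
    count R?                            ≤⟨ sum-mono (λ i → ind-cover R⊆P∪Q (P? i) (Q? i) (R? i)) ⟩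
    sum (λ i → ind (P? i) + ind (Q? i)) ≡⟨ ∑-distrib-+ (ind ∘ P?) (ind ∘ Q?) ⟩
    count P? + count Q?                 ∎
    where open ≤-Reasoning

count-full : ∀ {a p} {P : Pred (Fin a) p} (P? : Decidable P) → (∀ i → P i) → count P? ≡ a
count-full {zero}  P? all = refl
count-full {suc a} P? all with P? zero
... | yes _  = cong suc (count-full (P? ∘ suc) (all ∘ suc))
... | no ¬p = ⊥-elim (¬p (all zero))

module _ {a p} {P : Pred (Fin a) p} (P? : Decidable P) where

  count-mono : ∀ {q} {Q : Pred (Fin a) q} (Q? : Decidable Q) → P ⊆ Q → count P? ≤ count Q?
  count-mono Q? P⊆Q = sum-mono (λ i → ind-mono P⊆Q (P? i) (Q? i))

  count≤ : count P? ≤ a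
  count≤ = ≤-trans (count-mono (λ _ → yes tt) (λ _ → tt))
                   (≤-reflexive (count-full (λ _ → yes tt) (λ _ → tt)))

count-none : ∀ {a p} {P : Pred (Fin a) p} (P? : Decidable P) → (∀ {i} → ¬ P i) → count P? ≡ 0
count-none {zero}  P? none = refl
count-none {suc a} P? none with P? zero
... | yes p = ⊥-elim (none p)
... | no _  = count-none (P? ∘ suc) none

count-witness : ∀ {a p} {P : Pred (Fin a) p} (P? : Decidable P) → 1 ≤ count P? → ∃ P
count-witness {suc a} P? pos with P? zero
... | yes p = zero , p
... | no _  = let i , p = count-witness (P? ∘ suc) pos in suc i , p

count-member : ∀ {a p} {P : Pred (Fin a) p} (P? : Decidable P) {i} → P i → 1 ≤ count P?
count-member P? {zero} p with P? zero
... | yes _ = s≤s z≤n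
... | no ¬p = ⊥-elim (¬p p)
count-member P? {suc i} p = ≤-trans (count-member (P? ∘ suc) p) (m≤n+m _ (ind (P? zero)))

count-≡ : ∀ {a} (i₀ : Fin a) → count (_≟ i₀) ≤ 1
count-≡ {suc a} zero = ≤-reflexive (cong suc (count-none {a} (λ i → suc i ≟ zero) (λ ())))
count-≡ {suc a} (suc i₀) =
  ≤-trans (count-mono (λ i → suc i ≟ suc i₀) (_≟ i₀) suc-injective) (count-≡ i₀)

injective-∷ : ∀ {a k} {A : Set a} {x : A} {g : Vector A k} →
              (∀ i → g i ≢ x) → Injective _≡_ _≡_ g → Injective _≡_ _≡_ (x ∷ g)
injective-∷ new inj {zero}  {zero}  _ = refl
injective-∷ new inj {zero}  {suc j} e = ⊥-elim (new j (sym e))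
injective-∷ new inj {suc i} {zero}  e = ⊥-elim (new i e)
injective-∷ new inj {suc i} {suc j} e = cong suc (inj e)

count-injection : ∀ {a p m} {P : Pred (Fin a) p} (P? : Decidable P) → m ≤ count P? →
                  Σ (Fin m → Fin a) λ f → Injective _≡_ _≡_ f × ∀ j → P (f j)
count-injection {m = zero}  P? _ = (λ ()) , (λ { {()} }) , (λ ())
count-injection {suc a} {m = suc m} P? m≤count with P? zero
... | yes p = let f , inj , Pf = count-injection (P? ∘ suc) (≤-pred m≤count) in
  zero ∷ (suc ∘ f) , injective-∷ (λ _ ()) (λ e → inj (suc-injective e)) , λ { zero → p ; (suc j) → Pf j }
... | no _  = let f , inj , Pf = count-injection (P? ∘ suc) m≤count in
  suc ∘ f , (λ e → inj (suc-injective e)) , Pf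

opaque
  fresh : ∀ {n k} (f : Vector (Fin n) k) → k < n → ∃ λ v → ∀ j → f j ≢ v
  fresh {n} {k} f k<n =
    let v , unhit = ¬∀⟶∃¬ n _ (λ v → any? (λ j → f j ≟ v)) (<⇒≱ k<n ∘ surjective⇒n≤k)
    in v , λ j fj≡v → unhit (j , fj≡v)
    where
    surjective⇒n≤k : (∀ v → ∃ λ j → f j ≡ v) → n ≤ k
    surjective⇒n≤k hit = injective⇒≤ {f = proj₁ ∘ hit} λ {u} {v} e →
      trans (sym (proj₂ (hit u))) (trans (cong f e) (proj₂ (hit v)))

record Enumeration {a p k} {A : Set a} (P : Pred A p) (f : Vector A k) : Set (a ⊔ p) where
  field
    size      : ℕ
    size≤     : size ≤ k
    elem      : Vector A size
    injective : Injective _≡_ _≡_ elem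
    sound     : ∀ i → P (elem i)
    complete  : ∀ j → P (f j) → ∃ λ i → elem i ≡ f j

enumerate : ∀ {a p k} {A : Set a} {P : Pred A p} → DecidableEquality A → Decidable P →
            (f : Vector A k) → Enumeration P f
enumerate {k = zero}  _≟_ P? f = record
  { size = 0 ; size≤ = z≤n ; elem = [] ; injective = λ { {()} } ; sound = λ () ; complete = λ () }
enumerate {k = suc k} {P = P} _≟_ P? f = extend (enumerate _≟_ P? (f ∘ suc))
  where
  extend : Enumeration P (f ∘ suc) → Enumeration P f
  extend E with P? (f zero) | any? (λ i → Enumeration.elem E i ≟ f zero)
  ... | no ¬p | _ = record
    { size = size ; size≤ = m≤n⇒m≤1+n size≤ ; elem = elem ; injective = injective ; sound = sound
    ; complete = λ { zero p → ⊥-elim (¬p p) ; (suc j) → complete j } }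
    where open Enumeration E
  ... | yes _ | yes old = record
    { size = size ; size≤ = m≤n⇒m≤1+n size≤ ; elem = elem ; injective = injective ; sound = sound
    ; complete = λ { zero _ → old ; (suc j) → complete j } }
    where open Enumeration E
  ... | yes p | no new = record
    { size = suc size ; size≤ = s≤s size≤ ; elem = f zero ∷ elem
    ; injective = injective-∷ (λ i e → new (i , e)) injective
    ; sound = λ { zero → p ; (suc i) → sound i }
    ; complete = λ { zero _ → zero , refl ; (suc j) q → let i , e = complete j q in suc i , e } }
    where open Enumeration E

Apart : ∀ {n} → Graph n → Fin n → Fin n → Set
Apart G z v = z ≢ v × ¬ Adj G z v

IsEC-pred : ∀ {n l k} {G : Graph n} → l + suc k ≤ n → IsEC G l (suc k) → IsEC G l k
IsEC-pred {n} {l} {k} l+1+k≤n ec A B injA injB A≢B =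
  let z , z≢A , z≢vB , adjA , ¬adjvB = ec A (v ∷ B) injA (injective-∷ v∉B injB) A≢vB
  in z , z≢A , z≢vB ∘ suc , adjA , ¬adjvB ∘ suc
  where
  v,new : ∃ λ v → ∀ i → (A ++ B) i ≢ v
  v,new = fresh (A ++ B) (subst (_≤ n) (+-suc l k) l+1+k≤n)
  v : Fin n
  v = proj₁ v,new
  v∉A : ∀ i → A i ≢ v
  v∉A i = subst (_≢ v) (lookup-++ˡ A B i) (proj₂ v,new (i ↑ˡ k))
  v∉B : ∀ j → B j ≢ v
  v∉B j = subst (_≢ v) (lookup-++ʳ A B j) (proj₂ v,new (l ↑ʳ j))
  A≢vB : ∀ i j → A i ≢ (v ∷ B) j
  A≢vB i zero    = v∉A i
  A≢vB i (suc j) = A≢B i j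

IsEC-≤ : ∀ {n l k s} {G : Graph n} → k ≤ s → l + s ≤ n → IsEC G l s → IsEC G l k
IsEC-≤ {l = l} {k} {s} {G} k≤s l+s≤n ec with m≤n⇒m<n∨m≡n k≤s
... | inj₂ refl = ec
... | inj₁ (s≤s k≤s′) =
  IsEC-≤ {G = G} k≤s′ (≤-trans (+-monoʳ-≤ l (n≤1+n _)) l+s≤n) (IsEC-pred {G = G} l+s≤n ec)

module _ {n s} (G : Graph n) (ec : IsEC G 2 s) (s+2≤n : s + 2 ≤ n) where

  private
    2+s≤n : 2 + s ≤ n
    2+s≤n = subst (_≤ n) (+-comm s 2) s+2≤n

  commonNeighbour≢ : ∀ {k} → k ≤ s → {x x′ : Fin n} → x ≢ x′ → (S : Vector (Fin n) k) →
    ∃ λ z → Adj G z x × Adj G z x′ × ∀ j → S j ≢ x → S j ≢ x′ → Apart G z (S j)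
  commonNeighbour≢ k≤s {x} {x′} x≢x′ S =
    let z , _ , z≢elem , z~A , z≁elem = IsEC-≤ {G = G} (≤-trans size≤ k≤s) 2+s≤n ec A elem injA injective A≢elem
    in z , z~A zero , z~A (suc zero) , λ j Sj≢x Sj≢x′ →
         let i , elemi≡Sj = complete j (Sj≢x , Sj≢x′) in subst (Apart G z) elemi≡Sj (z≢elem i , z≁elem i)
    where
    open Enumeration (enumerate _≟_ (λ v → ¬? (v ≟ x) ×-dec ¬? (v ≟ x′)) S)
    A : Vector (Fin n) 2
    A = x ∷ x′ ∷ []
    A≢elem : ∀ i j → A i ≢ elem j
    A≢elem zero       j e = proj₁ (sound j) (sym e)
    A≢elem (suc zero) j e = proj₂ (sound j) (sym e)
    injA : Injective _≡_ _≡_ A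
    injA = injective-∷ (λ { zero e → x≢x′ (sym e) ; (suc ()) }) (injective-∷ (λ ()) (λ { {()} }))

  commonNeighbour : ∀ {k} → k ≤ s → (x x′ : Fin n) (S : Vector (Fin n) k) →
    ∃ λ z → Adj G z x × Adj G z x′ × ∀ j → S j ≢ x → S j ≢ x′ → Apart G z (S j)
  commonNeighbour k≤s x x′ S with x ≟ x′
  ... | no x≢x′ = commonNeighbour≢ k≤s x≢x′ S
  ... | yes refl =
    let d , new = fresh (x ∷ S) (≤-trans (s≤s (s≤s k≤s)) 2+s≤n)
        z , adj-x , _ , apart = commonNeighbour≢ k≤s (new zero) S
    in z , adj-x , adj-x , λ j Sj≢x _ → apart j Sj≢x (new (suc j))

tabulate-∷ʳ : ∀ {a n} {A : Set a} (f : Fin (suc n) → A) →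
              tabulate f ≡ tabulate (f ∘ inject₁) ∷ʳ f (fromℕ n)
tabulate-∷ʳ {n = zero}  f = refl
tabulate-∷ʳ {n = suc n} f = cong (f zero Vec.∷_) (tabulate-∷ʳ (f ∘ suc))

record RevolutionaryStrategy {n} (G : Graph n) (r m k : ℕ) : Set₁ where
  field
    Memory    : Set
    start     : Conf n r
    init      : Conf n k → Memory
    move      : Conf n r → Conf n k → Memory → Conf n r
    update    : Conf n r → Conf n k → Memory → Conf n k → Memory
    legal     : ∀ P S M → Step G P (move P S M)
    Invariant : Conf n r → Conf n k → Memory → Set
    potential : Conf n r → Conf n k → Memory → ℕ
    opening   : ∀ S → UnguardedMeeting m start S ⊎ Invariant start S (init S)
    progress  : ∀ {P S M S′} → Invariant P S M → Step G S S′ →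
                let P′ = move P S M ; M′ = update P S M S′ in
                UnguardedMeeting m P′ S′ ⊎ (Invariant P′ S′ M′ × potential P′ S′ M′ < potential P S M)

module Against {n} {G : Graph n} {r m k} (𝒮 : RevolutionaryStrategy G r m k)
               (σ : SpyStrategy n r k) where

  open RevolutionaryStrategy 𝒮

  prefix : (t : ℕ) → Vec (Conf n r) (suc t) × Memory
  prefix zero    = [ start ] , init (σ 0 [ start ])
  prefix (suc t) =
    let h , M = prefix t
        h′ = h ∷ʳ move (last h) (σ t h) M
    in h′ , update (last h) (σ t h) M (σ (suc t) h′)

  revs : ℕ → Conf n r
  revs t = last (proj₁ (prefix t))

  memory : ℕ → Memory
  memory t = proj₂ (prefix t)

  spies : ℕ → Conf n k
  spies = spyPlay σ revs

  prefix≡history : ∀ t → proj₁ (prefix t) ≡ history revs t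
  prefix≡history zero    = refl
  prefix≡history (suc t) = begin
    h ∷ʳ move (last h) (σ t h) (memory t)              ≡⟨ cong (h ∷ʳ_) (last-∷ʳ _ h) ⟨
    h ∷ʳ revs (suc t)                                  ≡⟨ cong (_∷ʳ revs (suc t)) (prefix≡history t) ⟩
    history revs t ∷ʳ revs (suc t)                     ≡⟨ cong₂ _∷ʳ_ (tabulate-cong (cong revs ∘ sym ∘ toℕ-inject₁))
                                                                     (cong revs (sym (toℕ-fromℕ (suc t)))) ⟩
    tabulate (revs ∘ toℕ ∘ inject₁) ∷ʳ revs (toℕ (fromℕ (suc t))) ≡⟨ tabulate-∷ʳ (revs ∘ toℕ) ⟨
    history revs (suc t)                               ∎
    where
    open ≡-Reasoning
    h : Vec (Conf n r) (suc t)
    h = proj₁ (prefix t)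

  revs-suc : ∀ t → revs (suc t) ≡ move (revs t) (spies t) (memory t)
  revs-suc t = trans (last-∷ʳ _ (proj₁ (prefix t)))
                     (cong (λ h → move (revs t) (σ t h) (memory t)) (prefix≡history t))

  memory-suc : ∀ t → memory (suc t) ≡ update (revs t) (spies t) (memory t) (spies (suc t))
  memory-suc t = cong₂ (λ h h′ → update (revs t) (σ t h) (memory t) (σ (suc t) h′))
                       (prefix≡history t) (prefix≡history (suc t))

  revs-legal : LegalRevPlay G revs
  revs-legal t = subst (Step G (revs t)) (sym (revs-suc t)) (legal _ _ _)

  after : ∀ t (Q : Conf n r → Memory → Set) →
          Q (move (revs t) (spies t) (memory t)) (update (revs t) (spies t) (memory t) (spies (suc t))) →
          Q (revs (suc t)) (memory (suc t))
  after t Q = subst₂ Q (sym (revs-suc t)) (sym (memory-suc t))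

spiesLose : ∀ {n} {G : Graph n} {r m k} → RevolutionaryStrategy G r m k → ¬ SpiesWin G r m k
spiesLose {G = G} {m = m} 𝒮 (σ , win) = [ no-meeting 0 , (λ inv → descend _ 0 inv ≤-refl) ]′ (opening (spies 0))
  where
  open RevolutionaryStrategy 𝒮
  open Against 𝒮 σ
  spies-legal : ∀ t → Step G (spies t) (spies (suc t))
  spies-legal = proj₁ (win revs revs-legal)
  no-meeting : ∀ t → ¬ UnguardedMeeting m (revs t) (spies t)
  no-meeting = proj₂ (win revs revs-legal)
  descend : ∀ N t → Invariant (revs t) (spies t) (memory t) → potential (revs t) (spies t) (memory t) < N → ⊥
  descend (suc N) t inv bound with progress inv (spies-legal t)
  ... | inj₁ meeting = no-meeting (suc t) (after t (λ P _ → UnguardedMeeting m P (spies (suc t))) meeting)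
  ... | inj₂ step =
    let inv′ , smaller = after t (λ P M → Invariant P (spies (suc t)) M ×
                                          potential P (spies (suc t)) M < potential (revs t) (spies t) (memory t)) step
    in descend N (suc t) inv′ (<-≤-trans smaller (≤-pred bound))

module _ {n : ℕ} where

  #at : ∀ {a} → Conf n a → Fin n → ℕ
  #at P v = count (λ i → P i ≟ v)

  Free : ∀ {a} → Conf n a → Fin n → Set
  Free P v = ∀ i → P i ≢ v

  #at-pair≤ : ∀ {a} (P : Conf n a) {u v} → u ≢ v → #at P u + #at P v ≤ a
  #at-pair≤ P u≢v = ≤-trans (count-disjoint (λ i → P i ≟ _) (λ i → P i ≟ _) (λ _ → yes tt)
                              (λ Pi≡u Pi≡v → u≢v (trans (sym Pi≡u) Pi≡v)) _ _)
                            (count≤ (λ _ → yes tt))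

  #at-free : ∀ {a} (P : Conf n a) {v} → Free P v → #at P v ≡ 0
  #at-free P free = count-none (λ i → P i ≟ _) (free _)

  #at-merge : ∀ {a} (P Q : Conf n a) {x x′ w} → x ≢ x′ →
              (∀ i → P i ≡ x ⊎ P i ≡ x′ → Q i ≡ w) → #at P x + #at P x′ ≤ #at Q w
  #at-merge P Q x≢x′ merged = count-disjoint (λ i → P i ≟ _) (λ i → P i ≟ _) (λ i → Q i ≟ _)
    (λ Pi≡x Pi≡x′ → x≢x′ (trans (sym Pi≡x) Pi≡x′)) (merged _ ∘ inj₁) (merged _ ∘ inj₂)

  meeting : ∀ {r k m} (P : Conf n r) (S : Conf n k) {v} → m ≤ #at P v → Free S v →
            UnguardedMeeting m P S
  meeting P S {v} m≤#v free = let f , inj , Pf = count-injection (λ i → P i ≟ v) m≤#v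
                              in v , (f , inj , Pf) , free

module _ {n} (G : Graph n) {k} {S S′ : Conf n k} (step : Step G S S′) where

  avoids : ∀ {z} j → Apart G z (S j) → S′ j ≢ z
  avoids j (z≢Sj , z≁Sj) S′j≡z with step j
  ... | inj₁ Sj≡S′j = z≢Sj (trans (sym S′j≡z) (sym Sj≡S′j))
  ... | inj₂ Sj~S′j = z≁Sj (Adj-sym G (subst (Adj G (S j)) S′j≡z Sj~S′j))

  stays-free : ∀ {z} → (∀ j → Apart G z (S j)) → Free S′ z
  stays-free apart j = avoids j (apart j)

  arrives-from : ∀ {y z} → (∀ j → S j ≢ y → Apart G z (S j)) → ∀ j → S′ j ≡ z → S j ≡ y
  arrives-from {y} apart j S′j≡z with S j ≟ y
  ... | yes Sj≡y = Sj≡y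
  ... | no Sj≢y  = ⊥-elim (avoids j (apart j Sj≢y) S′j≡z)

  #at-arrivals : ∀ {y z₀ z₁} → z₀ ≢ z₁ →
                 (∀ j → S j ≢ y → Apart G z₀ (S j)) → (∀ j → S j ≢ y → Apart G z₁ (S j)) →
                 #at S′ z₀ + #at S′ z₁ ≤ #at S y
  #at-arrivals z₀≢z₁ apart₀ apart₁ =
    count-disjoint (λ j → S′ j ≟ _) (λ j → S′ j ≟ _) (λ j → S j ≟ _)
                   (λ S′j≡z₀ S′j≡z₁ → z₀≢z₁ (trans (sym S′j≡z₀) S′j≡z₁))
                   (arrives-from apart₀ _) (arrives-from apart₁ _)

module _ {n r : ℕ} where

  gather : (P Q : Conf n r) (x x′ w : Fin n) → Conf n r
  gather P Q x x′ w i with P i ≟ x | P i ≟ x′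
  ... | yes _ | _     = w
  ... | no _  | yes _ = w
  ... | no _  | no _  = Q i

  gather-in : ∀ P Q {x x′ w} i → P i ≡ x ⊎ P i ≡ x′ → gather P Q x x′ w i ≡ w
  gather-in P Q {x} {x′} i at with P i ≟ x | P i ≟ x′ | at
  ... | yes _ | _     | _         = refl
  ... | no _  | yes _ | _         = refl
  ... | no ≢x | no _  | inj₁ ≡x   = ⊥-elim (≢x ≡x)
  ... | no _  | no ≢x′ | inj₂ ≡x′ = ⊥-elim (≢x′ ≡x′)

  gather-out : ∀ P Q {x x′ w} i → P i ≢ x → P i ≢ x′ → gather P Q x x′ w i ≡ Q i
  gather-out P Q {x} {x′} i ≢x ≢x′ with P i ≟ x | P i ≟ x′
  ... | yes ≡x | _      = ⊥-elim (≢x ≡x)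
  ... | no _   | yes ≡x′ = ⊥-elim (≢x′ ≡x′)
  ... | no _   | no _   = refl

  gather-step : ∀ (G : Graph n) P Q {x x′ w} → Adj G w x → Adj G w x′ → Step G P Q →
                Step G P (gather P Q x x′ w)
  gather-step G P Q {x} {x′} w~x w~x′ step i with P i ≟ x | P i ≟ x′
  ... | yes refl | _      = inj₂ (Adj-sym G w~x)
  ... | no _     | yes refl = inj₂ (Adj-sym G w~x′)
  ... | no _     | no _   = step i

  scatter : (P : Conf n r) (y : Fin n) (leader : Maybe (Fin r)) (y₀ y₁ : Fin n) → Conf n r
  scatter P y leader y₀ y₁ i with P i ≟ y | leader
  ... | no _  | _ = P i
  ... | yes _ | nothing = y₁
  ... | yes _ | just i₀ with i ≟ i₀
  ...   | yes _ = y₀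
  ...   | no _  = y₁

  scatter-leader : ∀ P {y y₀ y₁} i → P i ≡ y → scatter P y (just i) y₀ y₁ i ≡ y₀
  scatter-leader P {y} i Pi≡y with P i ≟ y
  ... | no Pi≢y = ⊥-elim (Pi≢y Pi≡y)
  ... | yes _ with i ≟ i
  ...   | yes _ = refl
  ...   | no i≢i = ⊥-elim (i≢i refl)

  scatter-follower : ∀ P {y y₀ y₁} i₀ i → P i ≡ y → i ≢ i₀ → scatter P y (just i₀) y₀ y₁ i ≡ y₁
  scatter-follower P {y} i₀ i Pi≡y i≢i₀ with P i ≟ y
  ... | no Pi≢y = ⊥-elim (Pi≢y Pi≡y)
  ... | yes _ with i ≟ i₀
  ...   | yes i≡i₀ = ⊥-elim (i≢i₀ i≡i₀)
  ...   | no _     = refl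

  scatter-step : ∀ (G : Graph n) P {y} leader {y₀ y₁} → Adj G y₀ y → Adj G y₁ y →
                 Step G P (scatter P y leader y₀ y₁)
  scatter-step G P {y} leader y₀~y y₁~y i with P i ≟ y | leader
  ... | no _     | _ = inj₁ refl
  ... | yes refl | nothing = inj₂ (Adj-sym G y₁~y)
  ... | yes refl | just i₀ with i ≟ i₀
  ...   | yes _ = inj₂ (Adj-sym G y₀~y)
  ...   | no _  = inj₂ (Adj-sym G y₁~y)

lex-<ˡ : ∀ {r a a′ b b′} → a′ < a → b′ ≤ r → a′ * suc r + b′ < a * suc r + b
lex-<ˡ {r} {a} {a′} {b} {b′} a′<a b′≤r = begin-strict
  a′ * suc r + b′   ≤⟨ +-monoʳ-≤ (a′ * suc r) b′≤r ⟩
  a′ * suc r + r    <⟨ +-monoʳ-< (a′ * suc r) (n<1+n r) ⟩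
  a′ * suc r + suc r ≡⟨ +-comm (a′ * suc r) (suc r) ⟩
  suc a′ * suc r    ≤⟨ *-monoˡ-≤ (suc r) a′<a ⟩
  a * suc r         ≤⟨ m≤m+n (a * suc r) b ⟩
  a * suc r + b     ∎
  where open ≤-Reasoning

lex-<ʳ : ∀ {r a a′ b b′} → a′ ≤ a → b′ < b → a′ * suc r + b′ < a * suc r + b
lex-<ʳ {r} a′≤a b′<b = +-mono-≤-< (*-monoˡ-≤ (suc r) a′≤a) b′<b

module Strategy {n r m s k : ℕ} (G : Graph n) (ec : IsEC G 2 s) (s+2≤n : s + 2 ≤ n)
                (k≤s : k ≤ s) (m+k≤r : m + k ≤ r) where

  record Plan : Set where
    constructor plan
    field
      x x′ y : Fin n

  module _ (S : Conf n k) (u v : Fin n) where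

    hub : Fin n
    hub = proj₁ (commonNeighbour G ec s+2≤n k≤s u v S)

    hub~ˡ : Adj G hub u
    hub~ˡ = proj₁ (proj₂ (commonNeighbour G ec s+2≤n k≤s u v S))

    hub~ʳ : Adj G hub v
    hub~ʳ = proj₁ (proj₂ (proj₂ (commonNeighbour G ec s+2≤n k≤s u v S)))

    hub-apart : ∀ j → S j ≢ u → S j ≢ v → Apart G hub (S j)
    hub-apart = proj₂ (proj₂ (proj₂ (commonNeighbour G ec s+2≤n k≤s u v S)))

  fork₀ fork₁ : Conf n k → Fin n → Fin n
  fork₀ S y = hub S y y
  fork₁ S y = hub S y (fork₀ S y)

  private
    1+k<n : suc k < n
    1+k<n = ≤-trans (s≤s (s≤s k≤s)) (subst (_≤ n) (+-comm s 2) s+2≤n)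

  spare : Conf n k → Fin n → Fin n
  spare S w = proj₁ (fresh (w ∷ S) 1+k<n)

  spare-new : ∀ S w → Free (w ∷ S) (spare S w)
  spare-new S w = proj₂ (fresh (w ∷ S) 1+k<n)

  leader : Conf n r → Fin n → Maybe (Fin r)
  leader P y with any? (λ i → P i ≟ y)
  ... | yes (i₀ , _) = just i₀
  ... | no _         = nothing

  leader-at : ∀ P y → 1 ≤ #at P y → ∃ λ i₀ → leader P y ≡ just i₀ × P i₀ ≡ y
  leader-at P y occupied with any? (λ i → P i ≟ y)
  ... | yes (i₀ , Pi₀≡y) = i₀ , refl , Pi₀≡y
  ... | no none          = ⊥-elim (none (count-witness (λ i → P i ≟ y) occupied))

  move : Conf n r → Conf n k → Plan → Conf n r
  move P S (plan x x′ y) = gather P (scatter P y (leader P y) (fork₀ S y) (fork₁ S y)) x x′ (hub S x x′)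

  -- In the first case the new plan is ready, so its third vertex is never used.
  update : Conf n r → Conf n k → Plan → Conf n k → Plan
  update _ S (plan x x′ y) S′ with any? (λ j → S′ j ≟ fork₁ S y) | any? (λ j → S′ j ≟ fork₀ S y)
  ... | no _  | _     = plan (hub S x x′) (fork₁ S y) (hub S x x′)
  ... | yes _ | no _  = plan (hub S x x′) (fork₀ S y) (fork₁ S y)
  ... | yes _ | yes _ = plan (hub S x x′) (spare S′ (hub S x x′)) (fork₁ S y)

  Pressing : Conf n r → Conf n k → Plan → Set
  Pressing P S (plan x x′ y) = 1 ≤ #at S y × m + #at S y ≤ #at P x + #at P x′ + #at P y

  Invariant : Conf n r → Conf n k → Plan → Set
  Invariant P S p@(plan x x′ y) =
    x ≢ x′ × Free S x × Free S x′ × (m ≤ #at P x + #at P x′ ⊎ Pressing P S p)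

  potential : Conf n r → Conf n k → Plan → ℕ
  potential P S (plan x x′ y) = #at S y * suc r + (r ∸ (#at P x + #at P x′))

  module Round {P : Conf n r} {S S′ : Conf n k} {x x′ y : Fin n}
               (x≢x′ : x ≢ x′) (free-x : Free S x) (free-x′ : Free S x′) (step : Step G S S′) where

    w y₀ y₁ : Fin n
    w  = hub S x x′
    y₀ = fork₀ S y
    y₁ = fork₁ S y

    P′ : Conf n r
    P′ = move P S (plan x x′ y)

    w-apart : ∀ j → Apart G w (S j)
    w-apart j = hub-apart S x x′ j (free-x j) (free-x′ j)

    w-free : Free S′ w
    w-free = stays-free G step w-apart

    F : ℕ
    F = #at P x + #at P x′

    gathered : F ≤ #at P′ w
    gathered = #at-merge P P′ x≢x′ (gather-in P _)

    module Split (pressing : Pressing P S (plan x x′ y)) (unready : F < m) where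

      j₀ : Fin k
      j₀ = proj₁ (count-witness (λ j → S j ≟ y) (proj₁ pressing))

      Sj₀≡y : S j₀ ≡ y
      Sj₀≡y = proj₂ (count-witness (λ j → S j ≟ y) (proj₁ pressing))

      -- The revolutionaries at y outnumber the spies there, since those at x, x′ are fewer than m.
      spies<revs : #at S y < #at P y
      spies<revs = +-cancelˡ-< F (#at S y) (#at P y) (begin-strict
        F + #at S y  <⟨ +-monoˡ-< (#at S y) unready ⟩
        m + #at S y  ≤⟨ proj₂ pressing ⟩
        F + #at P y  ∎)
        where open ≤-Reasoning

      private
        leadership : ∃ λ i₀ → leader P y ≡ just i₀ × P i₀ ≡ y
        leadership = leader-at P y (≤-trans (proj₁ pressing) (<⇒≤ spies<revs))

      i₀ : Fin r
      i₀ = proj₁ leadership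

      leads : leader P y ≡ just i₀
      leads = proj₁ (proj₂ leadership)

      Pi₀≡y : P i₀ ≡ y
      Pi₀≡y = proj₂ (proj₂ leadership)

      y-spied : ∀ {v} → Free S v → y ≢ v
      y-spied free y≡v = free j₀ (trans Sj₀≡y y≡v)

      w≁y : ¬ Adj G w y
      w≁y w~y = proj₂ (w-apart j₀) (subst (Adj G w) (sym Sj₀≡y) w~y)

      w≢y₀ : w ≢ y₀
      w≢y₀ w≡y₀ = w≁y (subst (λ v → Adj G v y) (sym w≡y₀) (hub~ˡ S y y))

      w≢y₁ : w ≢ y₁
      w≢y₁ w≡y₁ = w≁y (subst (λ v → Adj G v y) (sym w≡y₁) (hub~ˡ S y y₀))

      y₀≢y₁ : y₀ ≢ y₁
      y₀≢y₁ y₀≡y₁ = irrefl G (subst (λ v → Adj G v y₀) (sym y₀≡y₁) (hub~ʳ S y y₀))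

      y₀-apart : ∀ j → S j ≢ y → Apart G y₀ (S j)
      y₀-apart j Sj≢y = hub-apart S y y j Sj≢y Sj≢y

      y₁-apart : ∀ j → S j ≢ y → Apart G y₁ (S j)
      y₁-apart j Sj≢y = hub-apart S y y₀ j Sj≢y (λ Sj≡y₀ → proj₁ (y₀-apart j Sj≢y) (sym Sj≡y₀))

      scattered : ∀ i → P i ≡ y → P′ i ≡ scatter P y (just i₀) y₀ y₁ i
      scattered i Pi≡y = trans (gather-out P _ i (λ Pi≡x → y-spied free-x (trans (sym Pi≡y) Pi≡x))
                                                 (λ Pi≡x′ → y-spied free-x′ (trans (sym Pi≡y) Pi≡x′)))
                               (cong (λ l → scatter P y l y₀ y₁ i) leads)

      split : #at P y ≤ #at P′ y₀ + #at P′ y₁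
      split = count-cover (λ i → P′ i ≟ y₀) (λ i → P′ i ≟ y₁) (λ i → P i ≟ y) destination
        where
        destination : ∀ {i} → P i ≡ y → P′ i ≡ y₀ ⊎ P′ i ≡ y₁
        destination {i} Pi≡y with i ≟ i₀
        ... | yes refl = inj₁ (trans (scattered i Pi≡y) (scatter-leader P i Pi≡y))
        ... | no i≢i₀  = inj₂ (trans (scattered i Pi≡y) (scatter-follower P i₀ i Pi≡y i≢i₀))

      split₁ : #at P y ≤ #at P′ y₁ + 1
      split₁ = ≤-trans (count-cover (λ i → P′ i ≟ y₁) (_≟ i₀) (λ i → P i ≟ y) destination)
                       (+-monoʳ-≤ (#at P′ y₁) (count-≡ i₀))
        where
        destination : ∀ {i} → P i ≡ y → P′ i ≡ y₁ ⊎ i ≡ i₀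
        destination {i} Pi≡y with i ≟ i₀
        ... | yes i≡i₀ = inj₂ i≡i₀
        ... | no i≢i₀  = inj₁ (trans (scattered i Pi≡y) (scatter-follower P i₀ i Pi≡y i≢i₀))

      leader-arrives : 1 ≤ #at P′ y₀
      leader-arrives = count-member (λ i → P′ i ≟ y₀)
                                    (trans (scattered i₀ Pi₀≡y) (scatter-leader P i₀ Pi₀≡y))

      arrivals : #at S′ y₀ + #at S′ y₁ ≤ #at S y
      arrivals = #at-arrivals G step y₀≢y₁ y₀-apart y₁-apart

      y₁-unguarded : Free S′ y₁ →
        Invariant P′ S′ (plan w y₁ w) × potential P′ S′ (plan w y₁ w) < potential P S (plan x x′ y)
      y₁-unguarded free₁ = (w≢y₁ , w-free , free₁ , inj₁ ready) ,
                           lex-<ˡ (subst (_< #at S y) (sym (#at-free S′ w-free)) (proj₁ pressing))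
                                  (m∸n≤m r (#at P′ w + #at P′ y₁))
        where
        open ≤-Reasoning
        ready : m ≤ #at P′ w + #at P′ y₁
        ready = +-cancelʳ-≤ 1 m _ (begin
          m + 1                       ≤⟨ +-monoʳ-≤ m (proj₁ pressing) ⟩
          m + #at S y                 ≤⟨ proj₂ pressing ⟩
          F + #at P y                 ≤⟨ +-mono-≤ gathered split₁ ⟩
          #at P′ w + (#at P′ y₁ + 1)  ≡⟨ +-assoc (#at P′ w) (#at P′ y₁) 1 ⟨
          #at P′ w + #at P′ y₁ + 1    ∎)

      y₀-unguarded : 1 ≤ #at S′ y₁ → Free S′ y₀ →
        Invariant P′ S′ (plan w y₀ y₁) × potential P′ S′ (plan w y₀ y₁) < potential P S (plan x x′ y)
      y₀-unguarded guarded₁ free₀ = (w≢y₀ , w-free , free₀ , inj₂ (guarded₁ , pressing′)) ,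
                                    lex-<ʳ fewer (∸-monoʳ-< more (#at-pair≤ P′ w≢y₀))
        where
        open ≤-Reasoning
        fewer : #at S′ y₁ ≤ #at S y
        fewer = ≤-trans (m≤n+m (#at S′ y₁) (#at S′ y₀)) arrivals
        more : F < #at P′ w + #at P′ y₀
        more = subst (_≤ #at P′ w + #at P′ y₀) (+-comm F 1) (+-mono-≤ gathered leader-arrives)
        pressing′ : m + #at S′ y₁ ≤ #at P′ w + #at P′ y₀ + #at P′ y₁
        pressing′ = begin
          m + #at S′ y₁                  ≤⟨ +-monoʳ-≤ m fewer ⟩
          m + #at S y                    ≤⟨ proj₂ pressing ⟩
          F + #at P y                    ≤⟨ +-mono-≤ gathered split ⟩
          #at P′ w + (#at P′ y₀ + #at P′ y₁) ≡⟨ +-assoc (#at P′ w) (#at P′ y₀) (#at P′ y₁) ⟨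
          #at P′ w + #at P′ y₀ + #at P′ y₁ ∎

      both-guarded : 1 ≤ #at S′ y₀ → 1 ≤ #at S′ y₁ →
        let d = spare S′ w in
        Invariant P′ S′ (plan w d y₁) × potential P′ S′ (plan w d y₁) < potential P S (plan x x′ y)
      both-guarded guarded₀ guarded₁ = (spare-new S′ w zero , w-free , spare-new S′ w ∘ suc ,
                                        inj₂ (guarded₁ , pressing′)) , lex-<ˡ fewer (m∸n≤m r (#at P′ w + #at P′ d))
        where
        open ≤-Reasoning
        d : Fin n
        d = spare S′ w
        fewer : #at S′ y₁ < #at S y
        fewer = ≤-trans (+-monoˡ-≤ (#at S′ y₁) guarded₀) arrivals
        pressing′ : m + #at S′ y₁ ≤ #at P′ w + #at P′ d + #at P′ y₁
        pressing′ = +-cancelʳ-≤ 1 (m + #at S′ y₁) _ (begin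
          m + #at S′ y₁ + 1                ≡⟨ +-assoc m (#at S′ y₁) 1 ⟩
          m + (#at S′ y₁ + 1)              ≤⟨ +-monoʳ-≤ m (subst (_≤ #at S y) (+-comm 1 _) fewer) ⟩
          m + #at S y                      ≤⟨ proj₂ pressing ⟩
          F + #at P y                      ≤⟨ +-mono-≤ gathered split₁ ⟩
          #at P′ w + (#at P′ y₁ + 1)       ≡⟨ +-assoc (#at P′ w) (#at P′ y₁) 1 ⟨
          #at P′ w + #at P′ y₁ + 1         ≤⟨ +-monoˡ-≤ 1 (+-monoˡ-≤ (#at P′ y₁) (m≤m+n (#at P′ w) (#at P′ d))) ⟩
          #at P′ w + #at P′ d + #at P′ y₁ + 1 ∎)

      outcome : let p′ = update P S (plan x x′ y) S′ in
                Invariant P′ S′ p′ × potential P′ S′ p′ < potential P S (plan x x′ y)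
      outcome with any? (λ j → S′ j ≟ fork₁ S y) | any? (λ j → S′ j ≟ fork₀ S y)
      ... | no none₁       | _              = y₁-unguarded (λ j e → none₁ (j , e))
      ... | yes (_ , at₁)  | no none₀       = y₀-unguarded (count-member (λ j → S′ j ≟ y₁) at₁)
                                                           (λ j e → none₀ (j , e))
      ... | yes (_ , at₁)  | yes (_ , at₀)  = both-guarded (count-member (λ j → S′ j ≟ y₀) at₀)
                                                           (count-member (λ j → S′ j ≟ y₁) at₁)

  progress : ∀ {P S p S′} → Invariant P S p → Step G S S′ →
             let P′ = move P S p ; p′ = update P S p S′ in
             UnguardedMeeting m P′ S′ ⊎ (Invariant P′ S′ p′ × potential P′ S′ p′ < potential P S p)
  progress {P} {p = plan x x′ y} (x≢x′ , free-x , free-x′ , status) step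
    with m ≤? #at P x + #at P x′ | status
  ... | yes ready | _              = inj₁ (meeting P′ _ (≤-trans ready gathered) w-free)
    where open Round x≢x′ free-x free-x′ step
  ... | no unready | inj₁ ready    = ⊥-elim (unready ready)
  ... | no unready | inj₂ pressing = inj₂ (Split.outcome pressing (≰⇒> unready))
    where open Round x≢x′ free-x free-x′ step

  base : Fin n
  base = fromℕ< (≤-trans (s≤s z≤n) 1+k<n)

  massed : Conf n r
  massed _ = base

  #at-massed : #at massed base ≡ r
  #at-massed = count-full (λ _ → base ≟ base) (λ _ → refl)

  init : Conf n k → Plan
  init S = plan (spare S base) (spare S (spare S base)) base

  opening : ∀ S → UnguardedMeeting m massed S ⊎ Invariant massed S (init S)
  opening S with any? (λ j → S j ≟ base)
  ... | no none = inj₁ (meeting massed S (≤-trans (m≤m+n m k) (≤-trans m+k≤r (≤-reflexive (sym #at-massed))))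
                                (λ j e → none (j , e)))
  ... | yes (_ , at) = inj₂ (spare-new S x₀ zero , spare-new S base ∘ suc , spare-new S x₀ ∘ suc ,
                             inj₂ (count-member (λ j → S j ≟ base) at , bound))
    where
    open ≤-Reasoning
    x₀ x₁ : Fin n
    x₀ = spare S base
    x₁ = spare S x₀
    bound : m + #at S base ≤ #at massed x₀ + #at massed x₁ + #at massed base
    bound = begin
      m + #at S base   ≤⟨ +-monoʳ-≤ m (count≤ (λ j → S j ≟ base)) ⟩
      m + k            ≤⟨ m+k≤r ⟩
      r                ≡⟨ #at-massed ⟨
      #at massed base  ≤⟨ m≤n+m (#at massed base) (#at massed x₀ + #at massed x₁) ⟩
      #at massed x₀ + #at massed x₁ + #at massed base ∎

  strategy : RevolutionaryStrategy G r m k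
  strategy = record
    { Memory = Plan ; start = massed ; init = init ; move = move ; update = update
    ; legal = λ { P S (plan x x′ y) → gather-step G P _ (hub~ˡ S x x′) (hub~ʳ S x x′)
                    (scatter-step G P (leader P y) (hub~ˡ S y y) (hub~ˡ S y (fork₀ S y))) }
    ; Invariant = Invariant ; potential = potential ; opening = opening ; progress = progress }

module Shadowing {n r m b : ℕ} (G : Graph n) (b≤r : b ≤ r) (r<m+b : r < m + b) where

  shadowed : Fin b → Fin r
  shadowed j = inject≤ j b≤r

  shadow : SpyStrategy n r b
  shadow t h j = lookup h (fromℕ t) (shadowed j)

  shadow-play : ∀ ρ t j → spyPlay shadow ρ t j ≡ ρ t (shadowed j)
  shadow-play ρ t j = trans (cong (λ P → P (shadowed j)) (lookup∘tabulate (λ i → ρ (toℕ i)) (fromℕ t)))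
                            (cong (λ u → ρ u (shadowed j)) (toℕ-fromℕ t))

  -- An unguarded meeting consists of unshadowed revolutionaries, of which there are only r ∸ b < m.
  shadowed-safe : ∀ (P : Conf n r) → ¬ UnguardedMeeting m P (P ∘ shadowed)
  shadowed-safe P (v , (f , f-inj , at-v) , unguarded) with any? (λ j → toℕ (f j) <? b)
  ... | yes (j , fj<b) = unguarded (fromℕ< fj<b)
        (trans (cong P (toℕ-injective (trans (toℕ-inject≤ _ b≤r) (toℕ-fromℕ< fj<b)))) (at-v j))
  ... | no none = <⇒≱ r<m+b (begin
    m + b      ≤⟨ +-monoˡ-≤ b (injective⇒≤ g-inj) ⟩
    r ∸ b + b  ≡⟨ m∸n+n≡m b≤r ⟩
    r          ∎)
    where
    open ≤-Reasoning
    b≤f : ∀ j → b ≤ toℕ (f j)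
    b≤f j = ≮⇒≥ (λ fj<b → none (j , fj<b))
    g< : ∀ j → toℕ (f j) ∸ b < r ∸ b
    g< j = ∸-monoˡ-< (toℕ<n (f j)) (b≤f j)
    g : Fin m → Fin (r ∸ b)
    g j = fromℕ< (g< j)
    g-inj : Injective _≡_ _≡_ g
    g-inj {i} {j} e = f-inj (toℕ-injective (∸-cancelʳ-≡ (b≤f i) (b≤f j)
      (trans (sym (toℕ-fromℕ< (g< i))) (trans (cong toℕ e) (toℕ-fromℕ< (g< j))))))

  shadowWins : SpiesWin G r m b
  shadowWins = shadow , λ ρ legal →
    (λ t j → subst₂ (λ u v → u ≡ v ⊎ Adj G u v) (sym (shadow-play ρ t j)) (sym (shadow-play ρ (suc t) j))
                    (legal t (shadowed j))) ,
    (λ t (v , revs , unguarded) → shadowed-safe (ρ t) (v , revs , λ j → unguarded j ∘ trans (shadow-play ρ t j)))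

spiesLose-ec : ∀ {n r m s k} (G : Graph n) → IsEC G 2 s → s + 2 ≤ n → k ≤ s → m + k ≤ r →
              ¬ SpiesWin G r m k
spiesLose-ec G ec s+2≤n k≤s m+k≤r = spiesLose (Strategy.strategy G ec s+2≤n k≤s m+k≤r)

ec⇒σ≥ : ∀ {n r m s} (G : Graph n) → IsEC G 2 s → s + 2 ≤ n → m + s ≤ r → σ≥ G r m (suc s)
ec⇒σ≥ G ec s+2≤n m+s≤r k k<1+s =
  spiesLose-ec G ec s+2≤n (≤-pred k<1+s) (≤-trans (+-monoʳ-≤ _ (≤-pred k<1+s)) m+s≤r)

0<r∸m⇒m≤r : ∀ {r m} → 1 ≤ r ∸ m → m ≤ r
0<r∸m⇒m≤r 1≤r∸m = <⇒≤ (m∸n≢0⇒n<m (m<n⇒n≢0 1≤r∸m))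

s≤r∸m⇒m+s≤r : ∀ {r m s} → 1 ≤ s → s ≤ r ∸ m → m + s ≤ r
s≤r∸m⇒m+s≤r {r} {m} {s} 1≤s s≤r∸m =
  subst (_≤ r) (+-comm s m) (m≤o∸n⇒m+n≤o s (0<r∸m⇒m≤r (≤-trans 1≤s s≤r∸m)) s≤r∸m)

1+r∸m≤r : ∀ {r m} → 1 ≤ m → m ≤ r → suc (r ∸ m) ≤ r
1+r∸m≤r 1≤m m≤r = ∸-monoʳ-< 1≤m m≤r

r<m+1+r∸m : ∀ {r m} → m ≤ r → r < m + suc (r ∸ m)
r<m+1+r∸m {r} {m} m≤r = ≤-reflexive (sym (trans (+-suc m (r ∸ m)) (cong suc (m+[n∸m]≡n m≤r))))

theorem2p4 : (∀ (n r m s : ℕ) (G : Graph n) → 1 ≤ r → 1 ≤ m → 1 ≤ s →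
    s ≤ r ∸ m → s + 2 ≤ n → IsEC G 2 s → σ≥ G r m (suc s))
    × (∀ (n r m : ℕ) (G : Graph n) → 1 ≤ r → 1 ≤ m → 1 ≤ r ∸ m →
    (r ∸ m) + 2 ≤ n → IsEC G 2 (r ∸ m) → σ≡ G r m (suc (r ∸ m)))
theorem2p4 =
  (λ n r m s G _ _ 1≤s s≤r∸m s+2≤n ec → ec⇒σ≥ G ec s+2≤n (s≤r∸m⇒m+s≤r 1≤s s≤r∸m)) ,
  (λ n r m G _ 1≤m 1≤r∸m r∸m+2≤n ec →
     Shadowing.shadowWins G (1+r∸m≤r 1≤m (0<r∸m⇒m≤r 1≤r∸m)) (r<m+1+r∸m (0<r∸m⇒m≤r 1≤r∸m)) ,
     ec⇒σ≥ G ec r∸m+2≤n (s≤r∸m⇒m+s≤r 1≤r∸m ≤-refl))
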